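{- Let $b \in \mathbb{Z}\setminus\{ -1,0,1\}$ and let $D$ be a $b$-digital semigroup. Then: (i) If $x \in L_b(D)$ and $u \in N_b\setminus\{0\}$, then $u\,b^{x-1} \in D$. (ii) If $x, y \in L_b(D)$, then $x+y-1 \in L_b(D)$. (iii) There exist $x, y \in L_b(D)$ with $\gcd(x,y)=1$. (iv) Let $x, y \in L_b(D)$. If $b \ge 3$ then $x+y \in L_b(D)$, and if $b \le -3$ then $x+y+1 \in L_b(D)$.
   Context: Fix $b \in \mathbb{Z}\setminus\{ -1,0,1\}$ and let $N_b := \{0,1,\dots,|b|-1\}$. Put $Z_b := \mathbb{N}\setminus\{0\}$ if $b>0$ and $Z_b := \mathbb{Z}\setminus\{0\}$ if $b<0$ (here $\mathbb{N}=\{0,1,2,\dots\}$). Every $z \in Z_b$ has a unique representation $z=\sum_{i=0}^{n} u_i b^i$ with $u_0,\dots,u_n \in N_b$, $u_n \neq 0$; its length is $\ell_b(z) := n+1$, and $\ell_b(0):=1$. For $n \ge 1$ let $\Delta_b(n) := \{z \in Z_b : \ell_b(z)=n\}$. For $A \subseteq Z_b$ let $L_b(A) := \{\ell_b(a) : a \in A\}$. A $b$-digital semigroup is a (nonempty) subsemigroup $D$ of the multiplicative semigroup $(Z_b,\cdot)$ such that $\Delta_b(\ell_b(d)) \subseteq D$ for every $d \in D$. -}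

module Defs where

open import Data.Nat as ℕ using (ℕ; zero; suc)
open import Data.Integer as ℤ using (ℤ; +_; 0ℤ)
open import Data.List using (List; []; _∷_; _++_; [_]; length)
open import Data.List.Relation.Unary.All using (All)
open import Data.Product using (Σ; ∃; _×_)
open import Relation.Binary.PropositionalEquality using (_≡_)
open import Relation.Nullary using (¬_)

ValidBase : ℤ → Set
ValidBase b = 2 ℕ.≤ ℤ.∣ b ∣

Digit : ℤ → ℕ → Set
Digit b u = u ℕ.< ℤ.∣ b ∣

Zb : ℤ → ℤ → Set
Zb b z = (0ℤ ℤ.< b → 0ℤ ℤ.< z) × (b ℤ.< 0ℤ → ¬ (z ≡ 0ℤ))

eval : ℤ → List ℕ → ℤ
eval b []       = 0ℤ
eval b (u ∷ us) = + u ℤ.+ b ℤ.* eval b us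

-- z has a base-b representation z = Σ_{i=0}^{n} uᵢ bⁱ with digits in N_b,
-- uₙ ≠ 0, and k = n+1 digits; i.e. ℓ_b(z) = k (representation is unique).
HasLength : ℤ → ℤ → ℕ → Set
HasLength b z k =
  Σ (List ℕ) λ us → Σ ℕ λ u →
    All (Digit b) us × Digit b u × 0 ℕ.< u ×
    length (us ++ [ u ]) ≡ k × eval b (us ++ [ u ]) ≡ z

record DigitalSemigroup (b : ℤ) (D : ℤ → Set) : Set where
  field
    subset   : ∀ z → D z → Zb b z
    nonempty : ∃ λ z → D z
    mul      : ∀ x y → D x → D y → D (x ℤ.* y)
    digital  : ∀ d k → D d → HasLength b d k →
               ∀ z → Zb b z → HasLength b z k → D z

InL : ℤ → (ℤ → Set) → ℕ → Set
InL b D k = ∃ λ a → D a × HasLength b a k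

{-# OPTIONS --safe #-}
module Submission where

-- Membership in D depends only on length, so once x ∈ L_b(D) the number
-- u b^(x-1) (a nonzero digit followed by x - 1 zeros) lies in D.  The product of
-- two such numbers is u² b^(x+y-2), of length x + y - 2 + ℓ(u²): u = 1 gives (ii),
-- and u = |b| - 1 gives (iv), as (|b| - 1)² has two digits for b ≥ 3 and three for
-- b ≤ -3.  For (iii), any element of D has some length k (repeated Euclidean
-- division produces its digits), and k and 2k - 1 are coprime.

open import Defs
open import Data.Nat using (ℕ; _+_; _∸_; _<_)
open import Data.Nat.GCD using (gcd)
open import Data.Integer as ℤ using (ℤ; +_; -[1+_])
open import Data.Product using (Σ; _×_)
open import Relation.Binary.PropositionalEquality using (_≡_)

open import Data.Nat as ℕ using (zero; suc; _*_; _^_; _%_; _/_; z≤n; s≤s; z<s; NonZero; >-nonZero)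
import Data.Nat.Properties as ℕP
open import Data.Nat.DivMod using (m≡m%n+[m/n]*n; m%n<n; m/n<m)
open import Data.Nat.Divisibility using (_∣_; ∣1⇒≡1; ∣m+n∣m⇒∣n)
open import Data.Nat.GCD using (gcd[m,n]∣m; gcd[m,n]∣n)
open import Data.Nat.Induction using (<-rec)
import Data.Integer.Properties as ℤP
open import Data.Integer.Tactic.RingSolver using (solve-∀)
open import Data.List using ([]; _∷_; length)
open import Data.List.Properties using (length-++)
open import Data.List.Relation.Unary.All using ([]; _∷_)
open import Data.Product using (_,_; proj₁; proj₂; ∃; ∃₂; map)
open import Data.Sum using (inj₁; inj₂)
open import Data.Empty using (⊥-elim)
open import Relation.Nullary using (¬_)
open import Relation.Binary.PropositionalEquality using (refl; sym; trans; cong; subst; subst₂)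

hasLength-digit : ∀ {b d} → Digit b d → 0 < d → HasLength b (+ d) 1
hasLength-digit {b} {d} d<∣b∣ 0<d =
  [] , d , [] , d<∣b∣ , 0<d , refl ,
  trans (cong (ℤ._+_ (+ d)) (ℤP.*-zeroʳ b)) (ℤP.+-identityʳ (+ d))

hasLength-∷ : ∀ {b d q k z} → z ≡ + d ℤ.+ b ℤ.* q → Digit b d → HasLength b q k →
              HasLength b z (suc k)
hasLength-∷ {d = d} refl d<∣b∣ (us , u , us-digits , u-digit , 0<u , refl , refl) =
  d ∷ us , u , d<∣b∣ ∷ us-digits , u-digit , 0<u , refl , refl

hasLength⇒suc : ∀ {b z k} → HasLength b z k → ∃ λ j → k ≡ suc j
hasLength⇒suc (us , u , _ , _ , _ , refl , _) =
  length us , trans (length-++ us) (ℕP.+-comm (length us) 1)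

digit-0 : ∀ b → ValidBase b → Digit b 0
digit-0 b vb = ℕP.<-trans z<s vb

0<∣b∣∸1 : ∀ b → ValidBase b → 0 < ℤ.∣ b ∣ ∸ 1
0<∣b∣∸1 b vb = ℕP.∸-monoˡ-≤ 1 vb

digit-∣b∣∸1 : ∀ b → ValidBase b → Digit b (ℤ.∣ b ∣ ∸ 1)
digit-∣b∣∸1 b vb = ℕP.∸-monoʳ-< z<s (ℕP.<⇒≤ vb)

hasLength-*b^ : ∀ {b z k} → ValidBase b → HasLength b z k →
                ∀ j → HasLength b (z ℤ.* b ℤ.^ j) (k + j)
hasLength-*b^ {b} {z} {k} vb hz zero =
  subst₂ (HasLength b) (sym (ℤP.*-identityʳ z)) (sym (ℕP.+-identityʳ k)) hz
hasLength-*b^ {b} {z} {k} vb hz (suc j) =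
  subst (HasLength b _) (sym (ℕP.+-suc k j))
    (hasLength-∷ (shift z b (b ℤ.^ j)) (digit-0 b vb) (hasLength-*b^ vb hz j))
  where
  shift : ∀ Z B P → Z ℤ.* (B ℤ.* P) ≡ + 0 ℤ.+ B ℤ.* (Z ℤ.* P)
  shift = solve-∀

euclidean-division : ∀ {c} .{{_ : NonZero c}} → 1 < c → ∀ {n} → 0 < n →
                     ∃₂ λ r q → r < c × q < n × n ≡ r + q * c
euclidean-division {c} 1<c {n} 0<n =
  n % c , n / c , m%n<n n c , m/n<m n c {{>-nonZero 0<n}} 1<c , m≡m%n+[m/n]*n n c

pos-euclid : ∀ {n} r q c → n ≡ r + q * c → + n ≡ + r ℤ.+ + q ℤ.* + c
pos-euclid r q c refl =
  trans (ℤP.pos-+ r (q * c)) (cong (ℤ._+_ (+ r)) (ℤP.pos-* q c))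

quotient-0⇒n<c : ∀ {n r c} → n ≡ r + 0 * c → r < c → n < c
quotient-0⇒n<c {r = r} n≡r+0 r<c =
  subst (_< _) (sym (trans n≡r+0 (ℕP.+-identityʳ r))) r<c

-- For a negative base a positive remainder forces the borrow q ↦ q + 1.
quotient+1<n : ∀ {n r q c} → n ≡ r + suc q * c → 0 < r → 1 < c → suc (suc q) < n
quotient+1<n {q = q} {c} refl 0<r 1<c = ℕP.+-mono-≤-< 0<r (ℕP.m<m*n (suc q) c 1<c)

hasLength-positiveBase : ∀ {c} .{{_ : NonZero c}} → 1 < c →
                         ∀ n → 0 < n → ∃ (HasLength (+ c) (+ n))
hasLength-positiveBase {c} 1<c = <-rec _ step
  where
  step : ∀ n → (∀ {m} → m < n → 0 < m → ∃ (HasLength (+ c) (+ m))) →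
         0 < n → ∃ (HasLength (+ c) (+ n))
  step n rec 0<n with euclidean-division 1<c 0<n
  ... | r , zero , r<c , _ , n≡ = 1 , hasLength-digit (quotient-0⇒n<c n≡ r<c) 0<n
  ... | r , suc q , r<c , q<n , n≡ =
    map suc (hasLength-∷ (trans (pos-euclid r (suc q) c n≡) (swap (+ r) (+ suc q) (+ c))) r<c)
      (rec q<n z<s)
    where
    swap : ∀ R Q C → R ℤ.+ Q ℤ.* C ≡ R ℤ.+ C ℤ.* Q
    swap = solve-∀

-- A negative base needs positive and negative numbers simultaneously: the next
-- quotient of a positive number is negative and vice versa.
hasLength-negativeBase : ∀ {c′} → 1 < suc c′ → ∀ n → 0 < n →
  ∃ (HasLength -[1+ c′ ] (+ n)) × ∃ (HasLength -[1+ c′ ] (ℤ.- + n))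
hasLength-negativeBase {c′} 1<c = <-rec _ step
  where
  c = suc c′
  b = -[1+ c′ ]

  Both : ℕ → Set
  Both n = ∃ (HasLength b (+ n)) × ∃ (HasLength b (ℤ.- + n))

  flip-sign : ∀ R Q C → R ℤ.+ Q ℤ.* C ≡ R ℤ.+ (ℤ.- C) ℤ.* (ℤ.- Q)
  flip-sign = solve-∀

  negate-exact : ∀ Q C → ℤ.- (+ 0 ℤ.+ Q ℤ.* C) ≡ + 0 ℤ.+ (ℤ.- C) ℤ.* Q
  negate-exact = solve-∀

  negate-borrow : ∀ {N C} R Q D → N ≡ R ℤ.+ Q ℤ.* C → C ≡ R ℤ.+ D →
                  ℤ.- N ≡ D ℤ.+ (ℤ.- C) ℤ.* (+ 1 ℤ.+ Q)
  negate-borrow R Q D refl refl = ring R Q D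
    where
    ring : ∀ R Q D → ℤ.- (R ℤ.+ Q ℤ.* (R ℤ.+ D)) ≡ D ℤ.+ (ℤ.- (R ℤ.+ D)) ℤ.* (+ 1 ℤ.+ Q)
    ring = solve-∀

  step : ∀ n → (∀ {m} → m < n → 0 < m → Both m) → 0 < n → Both n
  step n rec 0<n with euclidean-division 1<c 0<n
  ... | r , q , r<c , q<n , n≡ = positive r q r<c q<n n≡ , negative r q r<c q<n n≡
    where
    positive : ∀ r q → r < c → q < n → n ≡ r + q * c → ∃ (HasLength b (+ n))
    positive r zero r<c _ n≡ = 1 , hasLength-digit (quotient-0⇒n<c n≡ r<c) 0<n
    positive r (suc q) r<c q<n n≡ =
      map suc (hasLength-∷ (trans (pos-euclid r (suc q) c n≡) (flip-sign (+ r) (+ suc q) (+ c)))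
                           r<c)
        (proj₂ (rec q<n z<s))

    negative : ∀ r q → r < c → q < n → n ≡ r + q * c → ∃ (HasLength b (ℤ.- + n))
    negative zero zero _ _ n≡0 = ⊥-elim (ℕP.<-irrefl (sym n≡0) 0<n)
    negative zero (suc q) _ q<n n≡ =
      map suc (hasLength-∷ (trans (cong ℤ.-_ (pos-euclid 0 (suc q) c n≡)) (negate-exact (+ suc q) (+ c)))
                           z<s)
        (proj₁ (rec q<n z<s))
    negative (suc r) q r<c q<n n≡ = map suc (hasLength-∷ eq c∸r<c) (hasLength-1+q q n≡)
      where
      c∸r<c : c ∸ suc r < c
      c∸r<c = ℕP.∸-monoʳ-< z<s (ℕP.<⇒≤ r<c)
      eq : ℤ.- + n ≡ + (c ∸ suc r) ℤ.+ b ℤ.* + suc q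
      eq = negate-borrow (+ suc r) (+ q) (+ (c ∸ suc r)) (pos-euclid (suc r) q c n≡)
             (trans (cong +_ (sym (ℕP.m+[n∸m]≡n (ℕP.<⇒≤ r<c)))) (ℤP.pos-+ (suc r) (c ∸ suc r)))
      hasLength-1+q : ∀ q → n ≡ suc r + q * c → ∃ (HasLength b (+ suc q))
      hasLength-1+q zero _ = 1 , hasLength-digit 1<c z<s
      hasLength-1+q (suc q) n≡ = proj₁ (rec (quotient+1<n n≡ z<s 1<c) z<s)

Zb⇒hasLength : ∀ {b z} → ValidBase b → Zb b z → ∃ (HasLength b z)
Zb⇒hasLength {+ zero} ()
Zb⇒hasLength {+ suc c′} {+ zero} vb (0<z , _) with 0<z (ℤ.+<+ z<s)
... | ℤ.+<+ ()
Zb⇒hasLength {+ suc c′} {+ suc n} vb _ = hasLength-positiveBase vb (suc n) z<s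
Zb⇒hasLength {+ suc c′} { -[1+ n ]} vb (0<z , _) with 0<z (ℤ.+<+ z<s)
... | ()
Zb⇒hasLength { -[1+ c′ ]} {+ zero} vb (_ , z≢0) = ⊥-elim (z≢0 ℤ.-<+ refl)
Zb⇒hasLength { -[1+ c′ ]} {+ suc n} vb _ = proj₁ (hasLength-negativeBase vb (suc n) z<s)
Zb⇒hasLength { -[1+ c′ ]} { -[1+ n ]} vb _ = proj₂ (hasLength-negativeBase vb (suc n) z<s)

pos-^ : ∀ c j → (+ c) ℤ.^ j ≡ + (c ^ j)
pos-^ c zero = refl
pos-^ c (suc j) = trans (cong (ℤ._*_ (+ c)) (pos-^ c j)) (sym (ℤP.pos-* c (c ^ j)))

Zb-digit*b^ : ∀ {b u} → ValidBase b → 0 < u → ∀ j → Zb b (+ u ℤ.* b ℤ.^ j)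
Zb-digit*b^ {+ zero} ()
Zb-digit*b^ {+ suc c′} {u} vb 0<u j = (λ _ → 0<u*b^j) , λ { (ℤ.+<+ ()) }
  where
  0<u*b^j : ℤ.0ℤ ℤ.< + u ℤ.* (+ suc c′) ℤ.^ j
  0<u*b^j = subst (ℤ._<_ ℤ.0ℤ)
              (sym (trans (cong (ℤ._*_ (+ u)) (pos-^ (suc c′) j)) (sym (ℤP.pos-* u _))))
              (ℤ.+<+ (ℕP.*-mono-≤ 0<u (ℕP.m^n>0 (suc c′) j)))
Zb-digit*b^ { -[1+ c′ ]} {u} vb 0<u j = (λ ()) , λ _ → u*b^j≢0
  where
  u*b^j≢0 : ¬ (+ u ℤ.* -[1+ c′ ] ℤ.^ j ≡ ℤ.0ℤ)
  u*b^j≢0 eq with ℤP.i*j≡0⇒i≡0∨j≡0 (+ u) eq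
  ... | inj₁ u≡0 = ℕP.<-irrefl (sym (ℤP.+-injective u≡0)) 0<u
  ... | inj₂ b^j≡0 with ℤP.i^n≡0⇒i≡0 -[1+ c′ ] j b^j≡0
  ... | ()

gcd[n,2n∸1]≡1 : ∀ n → .{{NonZero n}} → gcd n (n + n ∸ 1) ≡ 1
gcd[n,2n∸1]≡1 (suc i) = ∣1⇒≡1 d∣1
  where
  d = gcd (suc i) (i + suc i)
  d∣1+i : d ∣ suc i
  d∣1+i = gcd[m,n]∣m (suc i) (i + suc i)
  d∣i : d ∣ i
  d∣i = ∣m+n∣m⇒∣n (subst (d ∣_) (ℕP.+-comm i (suc i)) (gcd[m,n]∣n (suc i) (i + suc i)))
                   d∣1+i
  d∣1 : d ∣ 1
  d∣1 = ∣m+n∣m⇒∣n (subst (d ∣_) (ℕP.+-comm 1 i) d∣1+i) d∣i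

-- (|b| - 1)² has the digits 1, b - 2 when b ≥ 3 and 1, 2, 1 when b ≤ -3.
square-∣b∣∸1-length⁺ : ∀ {b} → + 3 ℤ.≤ b → HasLength b (+ (ℤ.∣ b ∣ ∸ 1) ℤ.* + (ℤ.∣ b ∣ ∸ 1)) 2
square-∣b∣∸1-length⁺ {+ suc (suc (suc t))} _ =
  hasLength-∷ (ring (+ t)) (s≤s (s≤s z≤n)) (hasLength-digit (ℕP.m<n+m (suc t) {2} z<s) z<s)
  where
  ring : ∀ T → (+ 2 ℤ.+ T) ℤ.* (+ 2 ℤ.+ T) ≡ + 1 ℤ.+ (+ 3 ℤ.+ T) ℤ.* (+ 1 ℤ.+ T)
  ring = solve-∀
square-∣b∣∸1-length⁺ {+ zero} (ℤ.+≤+ ())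
square-∣b∣∸1-length⁺ {+ suc zero} (ℤ.+≤+ (s≤s ()))
square-∣b∣∸1-length⁺ {+ suc (suc zero)} (ℤ.+≤+ (s≤s (s≤s ())))

square-∣b∣∸1-length⁻ : ∀ {b} → b ℤ.≤ -[1+ 2 ] → HasLength b (+ (ℤ.∣ b ∣ ∸ 1) ℤ.* + (ℤ.∣ b ∣ ∸ 1)) 3
square-∣b∣∸1-length⁻ { -[1+ suc (suc t) ]} _ =
  hasLength-∷ (ring (+ t)) (s≤s (s≤s z≤n))
    (hasLength-∷ refl (s≤s (s≤s (s≤s z≤n))) (hasLength-digit (s≤s (s≤s z≤n)) z<s))
  where
  ring : ∀ T → (+ 2 ℤ.+ T) ℤ.* (+ 2 ℤ.+ T) ≡
               + 1 ℤ.+ ℤ.- (+ 3 ℤ.+ T) ℤ.* (+ 2 ℤ.+ ℤ.- (+ 3 ℤ.+ T) ℤ.* + 1)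
  ring = solve-∀
square-∣b∣∸1-length⁻ { -[1+ zero ]} (ℤ.-≤- ())
square-∣b∣∸1-length⁻ { -[1+ suc zero ]} (ℤ.-≤- (s≤s ()))

module _ {b : ℤ} (vb : ValidBase b) {D : ℤ → Set} (ds : DigitalSemigroup b D) where
  open DigitalSemigroup ds

  digit*b^[x∸1]∈D : ∀ x → InL b D x → ∀ u → 0 < u → Digit b u → D (+ u ℤ.* b ℤ.^ (x ∸ 1))
  digit*b^[x∸1]∈D x (a , a∈D , ha) u 0<u u<∣b∣ with hasLength⇒suc ha
  ... | j , refl =
    digital a (suc j) a∈D ha _ (Zb-digit*b^ vb 0<u j)
      (hasLength-*b^ vb (hasLength-digit u<∣b∣ 0<u) j)

  x+y+ℓ[u²]∸2∈L : ∀ {x y u k} → InL b D x → InL b D y → 0 < u → Digit b u →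
                  HasLength b (+ u ℤ.* + u) k → InL b D (x + y + k ∸ 2)
  x+y+ℓ[u²]∸2∈L {x} {y} {u} {k} x∈L@(_ , _ , hx) y∈L@(_ , _ , hy) 0<u u<∣b∣ hu²
    with hasLength⇒suc hx | hasLength⇒suc hy
  ... | i , refl | j , refl =
    _ , mul _ _ (digit*b^[x∸1]∈D x x∈L u 0<u u<∣b∣) (digit*b^[x∸1]∈D y y∈L u 0<u u<∣b∣) ,
    subst₂ (HasLength b) (sym product) exponent (hasLength-*b^ vb hu² (i + j))
    where
    ring : ∀ U X Y → (U ℤ.* X) ℤ.* (U ℤ.* Y) ≡ (U ℤ.* U) ℤ.* (X ℤ.* Y)
    ring = solve-∀
    product : (+ u ℤ.* b ℤ.^ i) ℤ.* (+ u ℤ.* b ℤ.^ j) ≡ (+ u ℤ.* + u) ℤ.* b ℤ.^ (i + j)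
    product = trans (ring (+ u) (b ℤ.^ i) (b ℤ.^ j))
                (cong (ℤ._*_ (+ u ℤ.* + u)) (sym (ℤP.^-distribˡ-+-* b i j)))
    exponent : k + (i + j) ≡ suc i + suc j + k ∸ 2
    exponent = trans (ℕP.+-comm k (i + j)) (sym (cong (λ t → t + k ∸ 1) (ℕP.+-suc i j)))

  x+y∸1∈L : ∀ x y → InL b D x → InL b D y → InL b D (x + y ∸ 1)
  x+y∸1∈L x y x∈L y∈L =
    subst (InL b D) (cong (_∸ 2) (ℕP.+-comm (x + y) 1))
      (x+y+ℓ[u²]∸2∈L x∈L y∈L z<s vb (hasLength-digit vb z<s))

  coprime-lengths : Σ ℕ λ x → Σ ℕ λ y → InL b D x × InL b D y × gcd x y ≡ 1
  coprime-lengths with nonempty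
  ... | z , z∈D with Zb⇒hasLength vb (subset z z∈D)
  ... | k , hz with hasLength⇒suc hz
  ... | i , refl =
    suc i , suc i + suc i ∸ 1 , x∈L , x+y∸1∈L _ _ x∈L x∈L , gcd[n,2n∸1]≡1 (suc i)
    where
    x∈L : InL b D (suc i)
    x∈L = z , z∈D , hz

  x+y∈L : ∀ {x y} → InL b D x → InL b D y → + 3 ℤ.≤ b → InL b D (x + y)
  x+y∈L {x} {y} x∈L y∈L 3≤b =
    subst (InL b D) (ℕP.m+n∸n≡m (x + y) 2)
      (x+y+ℓ[u²]∸2∈L x∈L y∈L (0<∣b∣∸1 b vb) (digit-∣b∣∸1 b vb) (square-∣b∣∸1-length⁺ 3≤b))

  x+y+1∈L : ∀ {x y} → InL b D x → InL b D y → b ℤ.≤ -[1+ 2 ] → InL b D (x + y + 1)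
  x+y+1∈L {x} {y} x∈L y∈L b≤-3 =
    subst (InL b D) (ℕP.+-∸-assoc (x + y) (s≤s (s≤s z≤n)))
      (x+y+ℓ[u²]∸2∈L x∈L y∈L (0<∣b∣∸1 b vb) (digit-∣b∣∸1 b vb) (square-∣b∣∸1-length⁻ b≤-3))

lemma1p3 : (b : ℤ) → ValidBase b → (D : ℤ → Set) → DigitalSemigroup b D →
    ((x : ℕ) → InL b D x → (u : ℕ) → 0 < u → Digit b u →
      D (+ u ℤ.* (b ℤ.^ (x ∸ 1))))
    × ((x y : ℕ) → InL b D x → InL b D y → InL b D (x + y ∸ 1))
    × (Σ ℕ λ x → Σ ℕ λ y → InL b D x × InL b D y × gcd x y ≡ 1)
    × ((x y : ℕ) → InL b D x → InL b D y →
        (+ 3 ℤ.≤ b → InL b D (x + y)) × (b ℤ.≤ -[1+ 2 ] → InL b D (x + y + 1)))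
lemma1p3 b vb D ds =
  digit*b^[x∸1]∈D vb ds ,
  x+y∸1∈L vb ds ,
  coprime-lengths vb ds ,
  λ x y x∈L y∈L → x+y∈L vb ds x∈L y∈L , x+y+1∈L vb ds x∈L y∈L
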